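{- Let $n\ge 1$ and let $\mathcal{B}=\{\emptyset\}\sqcup\{(x,y): x\le y,\ x,y\in\overline{[n]}\}$ be the Kang--Kashiwara--Misra level $1$ perfect crystal of type $C_n^{(1)}$, with the Kang--Kashiwara--Misra energy function $H$ described in the context. Then $H(\emptyset\otimes\emptyset)=0$, $H(\emptyset\otimes(x,y))=H((x,y)\otimes\emptyset)=1$ for all $x\le y$ in $\overline{[n]}$, and for all $x\le y$, $x'\le y'$ in $\overline{[n]}$, $$H((x,y)\otimes(x',y'))=\begin{cases}\chi(x\ge x')+\chi(y\ge y')-\chi(y\ge y'>x\ge x') & \text{if } \overline{y'}\ne x,\\ \chi(x>x')+\chi(y>y')-\chi(y>y'>x>x') & \text{if } \overline{y'}=x,\end{cases}$$ where $\chi(P)=1$ if the proposition $P$ holds and $0$ otherwise.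
   Context: $\overline{[n]}=\{1,\dots,n,\overline{n},\dots,\overline{1}\}$ with total order $1<2<\dots<n<\overline{n}<\overline{n-1}<\dots<\overline{1}$ and the convention $\overline{\overline{k}}=k$. The crystal is identified with vectors $b=(x_1,\dots,x_n,\overline{x}_n,\dots,\overline{x}_1)$ of non-negative integers (coordinates indexed by $\overline{[n]}$) whose sum $s(b)=\sum_{k=1}^n(x_k+\overline{x}_k)$ is $0$ or $2$: $\emptyset$ corresponds to the zero vector, and $(x,y)$ (with $x\le y$) corresponds to $e_x+e_y$, where $e_j$ is the vector with a $1$ in position $j$ and $0$ elsewhere. For $b=(x_1,\dots,\overline{x}_1)$ and $b'=(x'_1,\dots,\overline{x}'_1)$ the Kang--Kashiwara--Misra energy function is $H(b\otimes b')=\max\{\theta_j,\theta'_j,\eta_j,\eta'_j : 1\le j\le n\}$ (each evaluated at $b\otimes b'$), where $\theta_j=\sum_{k=1}^{j-1}(\overline{x}_k-\overline{x}'_k)+\frac{s(b')-s(b)}{2}$, $\theta'_j=\sum_{k=1}^{j-1}(x'_k-x_k)+\frac{s(b)-s(b')}{2}$, $\eta_j=\sum_{k=1}^{j-1}(\overline{x}_k-\overline{x}'_k)+(\overline{x}_j-x_j)+\frac{s(b')-s(b)}{2}$, $\eta'_j=\sum_{k=1}^{j-1}(x'_k-x_k)+(x'_j-\overline{x}'_j)+\frac{s(b)-s(b')}{2}$. -}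

module Defs where

open import Data.Nat as ℕ using (ℕ; zero; suc)
open import Data.Nat.DivMod using (_/_)
open import Data.Integer as ℤ using (ℤ; +_; _+_; _-_; _⊔_)
open import Data.Fin as Fin using (Fin; toℕ; _↑ˡ_; opposite)
open import Data.Fin.Properties using (_≟_)
open import Data.List using (List; foldr; map; filter)
open import Data.List.Base using () renaming (allFin to allFinL)
open import Data.Vec as Vec using (Vec; foldr₁; tabulate)
open import Data.Bool using (Bool; if_then_else_)
open import Relation.Nullary using (Dec; does)

-- The index set \overline{[n]} = {1,…,n, n̄,…,1̄} with its total order is
-- represented by Fin (n + n) with its usual order:
--   position i (0 ≤ i < n)       is the letter  i+1
--   position n+n-1-i (0 ≤ i < n) is the letter  \overline{i+1}.
Letter : ℕ → Set
Letter n = Fin (n ℕ.+ n)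

unbar : ∀ {n} → Fin n → Letter n
unbar {n} i = i ↑ˡ n

bar : ∀ {n} → Letter n → Letter n
bar {n} = opposite {n ℕ.+ n}

barred : ∀ {n} → Fin n → Letter n
barred {n} i = bar {n} (unbar i)

data Crystal (n : ℕ) : Set where
  ∅c : Crystal n
  pr : (x y : Letter n) → Fin._≤_ {n ℕ.+ n} x y → Crystal n

e : ∀ {n} → Letter n → Letter n → ℕ
e {n} j i = if does (_≟_ {n ℕ.+ n} j i) then 1 else 0

-- vector (x_1,…,x_n, x̄_n,…,x̄_1) attached to b, indexed by letters
vec : ∀ {n} → Crystal n → Letter n → ℕ
vec ∅c i = 0
vec {n} (pr x y _) i = e {n} x i ℕ.+ e {n} y i

xc : ∀ {n} → Crystal n → Fin n → ℤ
xc {n} b i = + vec b (unbar {n} i)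

xbc : ∀ {n} → Crystal n → Fin n → ℤ
xbc {n} b i = + vec b (barred {n} i)

sumℕ : List ℕ → ℕ
sumℕ = foldr ℕ._+_ 0

sumℤ : List ℤ → ℤ
sumℤ = foldr _+_ (+ 0)

s : ∀ {n} → Crystal n → ℕ
s {n} b = sumℕ (map (vec b) (allFinL (n ℕ.+ n)))

-- Σ_{k=1}^{j-1} f(k) for j = i+1, i.e. sum of f over indices strictly below i
sumBelow : ∀ {n} → Fin n → (Fin n → ℤ) → ℤ
sumBelow {n} i f = sumℤ (map f (filter (λ k → toℕ k ℕ.<? toℕ i) (allFinL n)))

-- (s(b') - s(b)) / 2  (exact, since s is always 0 or 2)
halfDiff : ∀ {n} → Crystal n → Crystal n → ℤ
halfDiff b b' = (+ (s b' / 2)) - (+ (s b / 2))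

module _ {n : ℕ} (b b' : Crystal n) where
  θ : Fin n → ℤ
  θ j = sumBelow j (λ k → xbc b k - xbc b' k) + halfDiff b b'

  θ' : Fin n → ℤ
  θ' j = sumBelow j (λ k → xc b' k - xc b k) + halfDiff b' b

  η : Fin n → ℤ
  η j = sumBelow j (λ k → xbc b k - xbc b' k) + (xbc b j - xc b j) + halfDiff b b'

  η' : Fin n → ℤ
  η' j = sumBelow j (λ k → xc b' k - xc b k) + (xc b' j - xbc b' j) + halfDiff b' b

-- The KKM energy function H(b ⊗ b') = max_j {θ_j, θ'_j, η_j, η'_j},
-- defined for n = suc m ≥ 1 (the maximum is over a nonempty set).
H : ∀ {m} → Crystal (suc m) → Crystal (suc m) → ℤ
H b b' = foldr₁ _⊔_ (tabulate λ j → θ b b' j ⊔ θ' b b' j ⊔ η b b' j ⊔ η' b b' j)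

χ : ∀ {p} {P : Set p} → Dec P → ℤ
χ d = if does d then + 1 else + 0

module Submission where

-- Letters are handled through their positions z < N = 2n.  For b = (x, y), b' = (x', y') at
-- positions a ≤ b, a' ≤ b' and a threshold t < n (the paper's j is t + 1), each of θ_j, θ'_j, η_j,
-- η'_j is a difference of sums, over the four letters, of the indicators [z < t], [z ≤ t], [z = t],
-- [N ≤ z + t], [N ≤ z + t + 1] and [z + t + 1 = N]; the terms s/2 cancel.  These indicators are
-- monotone in z, which bounds every term by the value v ∈ {0, 1, 2} of the formula, and v is
-- attained at t = 0 or at the index of x or of y'.  When ȳ' = x, i.e. a + b' + 1 = N, the
-- indicators [a = t] and [b' + t + 1 = N] coincide, so the correction terms of η and η' cancel a
-- letter lying exactly at the threshold: equal positions a = a', b = b' then no longer count,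
-- which is why the second formula has strict inequalities.

open import Defs
open import Level using (Level)
open import Data.Nat using (ℕ; suc)
open import Data.Fin as Fin using (Fin; toℕ)
open import Data.Bool using (if_then_else_)
open import Data.List using (List; []; _∷_; map; filter)
open import Data.List.Base using () renaming (allFin to allFinL)
open import Data.List.Properties using (map-cong)
open import Data.List.Relation.Unary.Any using (Any; any?)
open import Data.List.Relation.Unary.All as All using (All)
open import Data.List.Relation.Unary.All.Properties using (All¬⇒¬Any)
open import Data.List.Relation.Unary.AllPairs using (_∷_)
open import Data.List.Relation.Unary.Unique.Propositional using (Unique)
open import Function using (_∘_; _⇔_; mk⇔; Equivalence)
open import Relation.Nullary using (Dec; yes; no; does; ¬_; contradiction)
open import Relation.Unary using (Decidable)
open import Relation.Binary.PropositionalEquality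
  using (_≡_; _≢_; refl; sym; trans; cong; cong₂; subst; module ≡-Reasoning)

module _ where
  open import Data.Nat using (_+_; _≤_; z≤n)
  open import Data.Nat.Properties using (≤-refl; ≤-reflexive; ≤-antisym)
  open import Data.Sum using (_⊎_; inj₁; inj₂; [_,_])

  𝟙 : ∀ {ℓ} {P : Set ℓ} → Dec P → ℕ
  𝟙 P? = if does P? then 1 else 0

  private
    variable
      ℓ : Level
      P Q R : Set ℓ

  𝟙-yes : (P? : Dec P) → P → 𝟙 P? ≡ 1
  𝟙-yes (yes _) _ = refl
  𝟙-yes (no ¬p) p = contradiction p ¬p

  𝟙-no : (P? : Dec P) → ¬ P → 𝟙 P? ≡ 0
  𝟙-no (yes p) ¬p = contradiction p ¬p
  𝟙-no (no _)  _  = refl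

  𝟙≤1 : (P? : Dec P) → 𝟙 P? ≤ 1
  𝟙≤1 (yes _) = ≤-refl
  𝟙≤1 (no _)  = z≤n

  𝟙-mono : (P? : Dec P) (Q? : Dec Q) → (P → Q) → 𝟙 P? ≤ 𝟙 Q?
  𝟙-mono (no _)  _  _   = z≤n
  𝟙-mono (yes p) Q? P⇒Q = ≤-reflexive (sym (𝟙-yes Q? (P⇒Q p)))

  𝟙-cong : (P? : Dec P) (Q? : Dec Q) → P ⇔ Q → 𝟙 P? ≡ 𝟙 Q?
  𝟙-cong P? Q? P⇔Q =
    ≤-antisym (𝟙-mono P? Q? (Equivalence.to P⇔Q)) (𝟙-mono Q? P? (Equivalence.from P⇔Q))

  𝟙-+-⊎ : (P? : Dec P) (Q? : Dec Q) (R? : Dec R) →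
          (P → ¬ Q) → R ⇔ (P ⊎ Q) → 𝟙 P? + 𝟙 Q? ≡ 𝟙 R?
  𝟙-+-⊎ (yes p) (yes q) _  P⇒¬Q _     = contradiction q (P⇒¬Q p)
  𝟙-+-⊎ (yes p) (no _)  R? _    R⇔P⊎Q = sym (𝟙-yes R? (Equivalence.from R⇔P⊎Q (inj₁ p)))
  𝟙-+-⊎ (no _)  (yes q) R? _    R⇔P⊎Q = sym (𝟙-yes R? (Equivalence.from R⇔P⊎Q (inj₂ q)))
  𝟙-+-⊎ (no ¬p) (no ¬q) R? _    R⇔P⊎Q = sym (𝟙-no R? ([ ¬p , ¬q ] ∘ Equivalence.to R⇔P⊎Q))

module _ where
  open import Data.Integer using (ℤ; _+_; _-_)
  import Data.Integer.Tactic.RingSolver as ℤ-Solver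

  [i-j]+[k-l]≡[i+k]-[j+l] : ∀ (i j k l : ℤ) → (i - j) + (k - l) ≡ (i + k) - (j + l)
  [i-j]+[k-l]≡[i+k]-[j+l] = ℤ-Solver.solve-∀

  [i-j]+[k-l]+[m-o]≡[i+k+m]-[j+l+o] : ∀ (i j k l m o : ℤ) →
                                      (i - j) + (k - l) + (m - o) ≡ (i + k + m) - (j + l + o)
  [i-j]+[k-l]+[m-o]≡[i+k+m]-[j+l+o] = ℤ-Solver.solve-∀

  [i+k]-[j+k]≡i-j : ∀ (i j k : ℤ) → (i + k) - (j + k) ≡ i - j
  [i+k]-[j+k]≡i-j = ℤ-Solver.solve-∀

  i+j-j≡i : ∀ (i j : ℤ) → i + j - j ≡ i
  i+j-j≡i = ℤ-Solver.solve-∀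

module _ {A : Set} where
  open import Data.Nat using (_+_)
  open import Data.Nat.Properties using (+-commutativeSemigroup)
  open import Algebra.Properties.CommutativeSemigroup +-commutativeSemigroup
    using () renaming (interchange to +-interchange)
  open import Data.Integer as ℤ using (ℤ; +_)

  sum-map-+ : (f g : A → ℕ) (xs : List A) →
              sumℕ (map (λ x → f x + g x) xs) ≡ sumℕ (map f xs) + sumℕ (map g xs)
  sum-map-+ f g [] = refl
  sum-map-+ f g (x ∷ xs) =
    trans (cong (_+_ (f x + g x)) (sum-map-+ f g xs))
          (+-interchange (f x) (g x) (sumℕ (map f xs)) (sumℕ (map g xs)))

  sum-map-0 : (xs : List A) → sumℕ (map (λ _ → 0) xs) ≡ 0
  sum-map-0 []       = refl
  sum-map-0 (_ ∷ xs) = sum-map-0 xs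

  sumℤ-map-- : (f g : A → ℕ) (xs : List A) →
               sumℤ (map (λ x → + f x ℤ.- + g x) xs) ≡ + sumℕ (map f xs) ℤ.- + sumℕ (map g xs)
  sumℤ-map-- f g [] = refl
  sumℤ-map-- f g (x ∷ xs) =
    trans (cong (ℤ._+_ (+ f x ℤ.- + g x)) (sumℤ-map-- f g xs))
          ([i-j]+[k-l]≡[i+k]-[j+l] (+ f x) (+ g x) (+ sumℕ (map f xs)) (+ sumℕ (map g xs)))

  sum-𝟙≡𝟙-any : {P : A → Set} (P? : Decidable P) {xs : List A} → Unique xs →
                (∀ {x y} → P x → P y → x ≡ y) →
                sumℕ (map (λ x → 𝟙 (P? x)) xs) ≡ 𝟙 (any? P? xs)
  sum-𝟙≡𝟙-any P? {[]} _ _ = refl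
  sum-𝟙≡𝟙-any P? {x ∷ xs} (x∉xs ∷ unique) P-unique with P? x
  ... | yes px = cong suc (trans (sum-𝟙≡𝟙-any P? unique P-unique) (𝟙-no (any? P? xs) none))
    where
    none : ¬ Any _ xs
    none = All¬⇒¬Any (All.map (λ x≢y py → x≢y (P-unique px py)) x∉xs)
  ... | no _ = sum-𝟙≡𝟙-any P? unique P-unique

module _ where
  open import Data.Nat using (_≤_; _<_; _∸_; _+_)
  open import Data.Nat.Properties
    using (+-suc; +-comm; m∸n+n≡m; m+n∸n≡m; +-monoˡ-≤; +-cancelʳ-≤; module ≤-Reasoning)
  open ≤-Reasoning

  ≡∸suc⇔suc+≡ : ∀ {a b m} → b < m → (a ≡ m ∸ suc b) ⇔ (suc (a + b) ≡ m)
  ≡∸suc⇔suc+≡ {a} {b} {m} b<m = mk⇔ to from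
    where
    to : a ≡ m ∸ suc b → suc (a + b) ≡ m
    to refl = trans (sym (+-suc (m ∸ suc b) b)) (m∸n+n≡m b<m)
    from : suc (a + b) ≡ m → a ≡ m ∸ suc b
    from refl = sym (trans (cong (_∸ suc b) (sym (+-suc a b))) (m+n∸n≡m a (suc b)))

  ∸suc<⇔≤+ : ∀ {c m t} → c < m → (m ∸ suc c < t) ⇔ (m ≤ c + t)
  ∸suc<⇔≤+ {c} {m} {t} c<m = mk⇔ to from
    where
    m≡ : suc (m ∸ suc c) + c ≡ m
    m≡ = trans (sym (+-suc (m ∸ suc c) c)) (m∸n+n≡m c<m)
    to : m ∸ suc c < t → m ≤ c + t
    to h = begin
      m                    ≡⟨ sym m≡ ⟩
      suc (m ∸ suc c) + c  ≤⟨ +-monoˡ-≤ c h ⟩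
      t + c                ≡⟨ +-comm t c ⟩
      c + t                ∎
    from : m ≤ c + t → m ∸ suc c < t
    from h = +-cancelʳ-≤ c (suc (m ∸ suc c)) t (begin
      suc (m ∸ suc c) + c  ≡⟨ m≡ ⟩
      m                    ≤⟨ h ⟩
      c + t                ≡⟨ +-comm c t ⟩
      t + c                ∎)

module _ {n : ℕ} where
  open import Data.Nat using (_+_; _∸_; _≤_; _<_; _<?_; _≤?_; _≟_)
  open import Data.Nat.Properties using (<-≤-trans; <⇒≤)
  open import Data.Fin using (opposite; fromℕ<)
  open import Data.Fin.Properties
    using (toℕ<n; toℕ-injective; toℕ-↑ˡ; ↑ˡ-injective; opposite-prop; opposite-involutive; toℕ-fromℕ<)
  open import Data.List.Membership.Propositional using (find; lose)
  open import Data.List.Membership.Propositional.Properties using (∈-filter⁺; ∈-filter⁻; ∈-allFin)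
  import Data.List.Relation.Unary.Unique.Propositional.Properties as Unique
  open import Data.Product using (_,_)

  below : Fin n → List (Fin n)
  below j = filter (λ k → toℕ k <? toℕ j) (allFinL n)

  ≡unbar⇔ : (w : Letter n) (k : Fin n) → (w ≡ unbar k) ⇔ (toℕ w ≡ toℕ k)
  ≡unbar⇔ w k = mk⇔ (λ w≡k → trans (cong toℕ w≡k) (toℕ-↑ˡ k n))
                    (λ w≡k → toℕ-injective (trans w≡k (sym (toℕ-↑ˡ k n))))

  ≡opposite⇔ : (z w : Letter n) → (z ≡ opposite w) ⇔ (suc (toℕ z + toℕ w) ≡ n + n)
  ≡opposite⇔ z w = mk⇔
    (λ z≡w̄ → Equivalence.to arith (trans (cong toℕ z≡w̄) (opposite-prop w)))
    (λ h → toℕ-injective (trans (Equivalence.from arith h) (sym (opposite-prop w))))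
    where
    arith : (toℕ z ≡ n + n ∸ suc (toℕ w)) ⇔ (suc (toℕ z + toℕ w) ≡ n + n)
    arith = ≡∸suc⇔suc+≡ (toℕ<n w)

  bar≡⇔ : (x y : Letter n) → (bar {n} y ≡ x) ⇔ (suc (toℕ x + toℕ y) ≡ n + n)
  bar≡⇔ x y = mk⇔ (λ ȳ≡x → Equivalence.to (≡opposite⇔ x y) (sym ȳ≡x))
                  (sym ∘ Equivalence.from (≡opposite⇔ x y))

  unique-below : (j : Fin n) → Unique (below j)
  unique-below j = Unique.filter⁺ (λ k → toℕ k <? toℕ j) (Unique.allFin⁺ n)

  any-below⇔ : (w : Letter n) (j : Fin n) → Any (λ k → w ≡ unbar k) (below j) ⇔ (toℕ w < toℕ j)
  any-below⇔ w j = mk⇔ to from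
    where
    to : Any (λ k → w ≡ unbar k) (below j) → toℕ w < toℕ j
    to any with find any
    ... | k , k∈below , w≡k with ∈-filter⁻ (λ k → toℕ k <? toℕ j) {xs = allFinL n} k∈below
    ...   | _ , k<j = subst (_< toℕ j) (sym (Equivalence.to (≡unbar⇔ w k) w≡k)) k<j
    from : toℕ w < toℕ j → Any (λ k → w ≡ unbar k) (below j)
    from w<j = lose (∈-filter⁺ (λ k → toℕ k <? toℕ j) (∈-allFin k) k<j)
                    (Equivalence.from (≡unbar⇔ w k) (sym (toℕ-fromℕ< w<n)))
      where
      w<n : toℕ w < n
      w<n = <-≤-trans w<j (<⇒≤ (toℕ<n j))
      k : Fin n
      k = fromℕ< w<n
      k<j : toℕ k < toℕ j
      k<j = subst (_< toℕ j) (sym (toℕ-fromℕ< w<n)) w<j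

  count-unbarred : (z : Letter n) (j : Fin n) →
                   sumℕ (map (λ k → e {n} z (unbar k)) (below j)) ≡ 𝟙 (toℕ z <? toℕ j)
  count-unbarred z j = trans
    (sum-𝟙≡𝟙-any (λ k → z Fin.≟ unbar k) (unique-below j)
                 (λ z≡k z≡k′ → ↑ˡ-injective n _ _ (trans (sym z≡k) z≡k′)))
    (𝟙-cong (any? (λ k → z Fin.≟ unbar k) (below j)) (toℕ z <? toℕ j) (any-below⇔ z j))

  -- Barred letters below j in z are the unbarred ones below j in the mirror image of z.
  count-barred : (z : Letter n) (j : Fin n) →
                 sumℕ (map (λ k → e {n} z (barred k)) (below j)) ≡ 𝟙 (n + n ≤? toℕ z + toℕ j)
  count-barred z j = begin
    sumℕ (map (λ k → e {n} z (barred k)) (below j))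
      ≡⟨ cong sumℕ (map-cong mirror (below j)) ⟩
    sumℕ (map (λ k → e {n} (opposite z) (unbar k)) (below j))
      ≡⟨ count-unbarred (opposite z) j ⟩
    𝟙 (toℕ (opposite z) <? toℕ j)
      ≡⟨ 𝟙-cong (toℕ (opposite z) <? toℕ j) (n + n ≤? toℕ z + toℕ j) opposite<⇔ ⟩
    𝟙 (n + n ≤? toℕ z + toℕ j) ∎
    where
    open ≡-Reasoning
    mirror : ∀ k → e {n} z (barred k) ≡ e {n} (opposite z) (unbar k)
    mirror k = 𝟙-cong (z Fin.≟ barred k) (opposite z Fin.≟ unbar k) (mk⇔
      (λ z≡k̄ → trans (cong opposite z≡k̄) (opposite-involutive (unbar k)))
      (λ z̄≡k → trans (sym (opposite-involutive z)) (cong opposite z̄≡k)))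
    opposite<⇔ : (toℕ (opposite z) < toℕ j) ⇔ (n + n ≤ toℕ z + toℕ j)
    opposite<⇔ = mk⇔
      (λ h → Equivalence.to (∸suc<⇔≤+ (toℕ<n z)) (subst (_< toℕ j) (opposite-prop z) h))
      (λ h → subst (_< toℕ j) (sym (opposite-prop z)) (Equivalence.from (∸suc<⇔≤+ (toℕ<n z)) h))

  e-unbar : (z : Letter n) (j : Fin n) → e {n} z (unbar j) ≡ 𝟙 (toℕ z ≟ toℕ j)
  e-unbar z j = 𝟙-cong (z Fin.≟ unbar j) (toℕ z ≟ toℕ j) (≡unbar⇔ z j)

  e-barred : (z : Letter n) (j : Fin n) → e {n} z (barred j) ≡ 𝟙 (suc (toℕ z + toℕ j) ≟ n + n)
  e-barred z j = 𝟙-cong (z Fin.≟ barred j) (suc (toℕ z + toℕ j) ≟ n + n)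
    (subst (λ u → (z ≡ barred j) ⇔ (suc (toℕ z + u) ≡ n + n)) (toℕ-↑ˡ j n) (≡opposite⇔ z (unbar j)))

  s-pr : (x y : Letter n) (p : x Fin.≤ y) → s {n} (pr x y p) ≡ 2
  s-pr x y p = trans (sum-map-+ (e {n} x) (e {n} y) (allFinL (n + n))) (cong₂ _+_ (once x) (once y))
    where
    once : (z : Letter n) → sumℕ (map (e {n} z) (allFinL (n + n))) ≡ 1
    once z = trans
      (sum-𝟙≡𝟙-any (z Fin.≟_) (Unique.allFin⁺ (n + n)) (λ z≡u z≡v → trans (sym z≡u) z≡v))
      (𝟙-yes (any? (z Fin.≟_) (allFinL (n + n))) (∈-allFin z))

  s-∅ : s {n} ∅c ≡ 0
  s-∅ = sum-map-0 (allFinL (n + n))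

module Positions (n : ℕ) where
  open import Data.Nat using (_+_; _*_; _∸_; _≤_; _<_; _<?_)
  open import Data.Nat.Properties
  open import Data.Product using (∃; _×_; _,_)

  N : ℕ
  N = n + n

  suc+<N : ∀ {z w} → z < n → w < n → suc (z + w) < N
  suc+<N {z} {w} z<n w<n = subst (_≤ N) (cong suc (+-suc z w)) (+-mono-≤ z<n w<n)

  suc[z+z]≢N : ∀ {z} → suc (z + z) ≢ N
  suc[z+z]≢N {z} eq = even≢odd n z (trans (2*m≡m+m n) (trans (sym eq) (cong suc (sym (2*m≡m+m z)))))
    where
    2*m≡m+m : ∀ m → 2 * m ≡ m + m
    2*m≡m+m m = cong (m +_) (+-identityʳ m)

  barred-index : ∀ {z} → n ≤ z → z < N → ∃ λ t → t < n × suc (z + t) ≡ N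
  barred-index {z} n≤z z<N =
      N ∸ suc z
    , Equivalence.from (∸suc<⇔≤+ z<N) (+-monoˡ-≤ n n≤z)
    , trans (cong suc (+-comm z (N ∸ suc z))) (Equivalence.to (≡∸suc⇔suc+≡ z<N) refl)

  data LetterIndex (z : ℕ) : Set where
    unbarred-letter : z < n → LetterIndex z
    barred-letter   : ∀ t → t < n → n ≤ z → suc (z + t) ≡ N → LetterIndex z

  letterIndex : ∀ {z} → z < N → LetterIndex z
  letterIndex {z} z<N with z <? n
  ... | yes z<n = unbarred-letter z<n
  ... | no z≮n with barred-index (≮⇒≥ z≮n) z<N
  ...   | t , t<n , z-at-t = barred-letter t t<n (≮⇒≥ z≮n) z-at-t

  module _ {a b' : ℕ} (a<b' : a < b') (suc[a+b']≡N : suc (a + b') ≡ N) where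

    opposite⇒<n : a < n
    opposite⇒<n with a <? n
    ... | yes a<n = a<n
    ... | no a≮n = contradiction (+-mono-≤ n≤a n≤a)
                                 (<⇒≱ (<-trans (+-monoʳ-< a a<b') (≤-reflexive suc[a+b']≡N)))
      where
      n≤a : n ≤ a
      n≤a = ≮⇒≥ a≮n

    opposite⇒n≤ : n ≤ b'
    opposite⇒n≤ with b' <? n
    ... | yes b'<n = contradiction suc[a+b']≡N (<⇒≢ (suc+<N (<-trans a<b' b'<n) b'<n))
    ... | no b'≮n = ≮⇒≥ b'≮n

module Thresholds (n t : ℕ) where
  open import Data.Nat using (_+_; _≤_; _<_; _≤?_; _<?_; _≟_; s≤s; s≤s⁻¹)
  open import Data.Nat.Properties
  open import Algebra.Properties.CommutativeSemigroup +-commutativeSemigroup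
    using () renaming (interchange to +-interchange)
  open import Data.Sum as Sum using ([_,_])
  open Positions n

  -- The contributions of the letter at position z to Σ_{k<t} x_k, x_t, Σ_{k≤t} x_k and to
  -- Σ_{k<t} x̄_k, x̄_t, Σ_{k≤t} x̄_k, with letters indexed from 0.
  xBelow xAt xUpTo x̄Below x̄At x̄UpTo : ℕ → ℕ
  xUpTo z = 𝟙 (z ≤? t)
  xAt z = 𝟙 (z ≟ t)
  xBelow z = xUpTo (suc z)
  x̄Below z = 𝟙 (N ≤? z + t)
  x̄At z = 𝟙 (suc (z + t) ≟ N)
  x̄UpTo z = x̄Below (suc z)

  xUpTo≡1 : ∀ {z} → z ≤ t → xUpTo z ≡ 1
  xUpTo≡1 {z} = 𝟙-yes (z ≤? t)

  xUpTo≡0 : ∀ {z} → t < z → xUpTo z ≡ 0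
  xUpTo≡0 {z} t<z = 𝟙-no (z ≤? t) (<⇒≱ t<z)

  x̄Below≡1 : ∀ {z} → N ≤ z + t → x̄Below z ≡ 1
  x̄Below≡1 {z} = 𝟙-yes (N ≤? z + t)

  x̄Below≡0 : ∀ {z} → z + t < N → x̄Below z ≡ 0
  x̄Below≡0 {z} z+t<N = 𝟙-no (N ≤? z + t) (<⇒≱ z+t<N)

  xAt≡0 : ∀ {z} → z ≢ t → xAt z ≡ 0
  xAt≡0 {z} = 𝟙-no (z ≟ t)

  xAt≡0-barred : ∀ {z} → t < n → n ≤ z → xAt z ≡ 0
  xAt≡0-barred t<n n≤z = xAt≡0 (>⇒≢ (<-≤-trans t<n n≤z))

  x̄At≡0 : ∀ {z} → suc (z + t) ≢ N → x̄At z ≡ 0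
  x̄At≡0 {z} = 𝟙-no (suc (z + t) ≟ N)

  x̄At≡0-unbarred : ∀ {z} → t < n → z < n → x̄At z ≡ 0
  x̄At≡0-unbarred t<n z<n = x̄At≡0 (<⇒≢ (suc+<N z<n t<n))

  xUpTo≤1 : ∀ z → xUpTo z ≤ 1
  xUpTo≤1 z = 𝟙≤1 (z ≤? t)

  x̄Below≤1 : ∀ z → x̄Below z ≤ 1
  x̄Below≤1 z = 𝟙≤1 (N ≤? z + t)

  xUpTo-antitone : ∀ {z w} → z ≤ w → xUpTo w ≤ xUpTo z
  xUpTo-antitone {z} {w} z≤w = 𝟙-mono (w ≤? t) (z ≤? t) (≤-trans z≤w)

  x̄Below-monotone : ∀ {z w} → z ≤ w → x̄Below z ≤ x̄Below w
  x̄Below-monotone {z} {w} z≤w =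
    𝟙-mono (N ≤? z + t) (N ≤? w + t) (λ N≤z+t → ≤-trans N≤z+t (+-monoˡ-≤ t z≤w))

  module AtBarred {w : ℕ} (w-at-t : suc (w + t) ≡ N) where

    ≤⇒x̄Below≡0 : ∀ {z} → z ≤ w → x̄Below z ≡ 0
    ≤⇒x̄Below≡0 z≤w = x̄Below≡0 (≤-trans (s≤s (+-monoˡ-≤ t z≤w)) (≤-reflexive w-at-t))

    >⇒x̄Below≡1 : ∀ {z} → w < z → x̄Below z ≡ 1
    >⇒x̄Below≡1 w<z = x̄Below≡1 (≤-trans (≤-reflexive (sym w-at-t)) (+-monoˡ-≤ t w<z))

    <⇒x̄UpTo≡0 : ∀ {z} → z < w → x̄UpTo z ≡ 0
    <⇒x̄UpTo≡0 = ≤⇒x̄Below≡0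

    ≥⇒x̄UpTo≡1 : ∀ {z} → w ≤ z → x̄UpTo z ≡ 1
    ≥⇒x̄UpTo≡1 w≤z = >⇒x̄Below≡1 (s≤s w≤z)

  xBelow+xAt≡xUpTo : ∀ z → xBelow z + xAt z ≡ xUpTo z
  xBelow+xAt≡xUpTo z =
    𝟙-+-⊎ (z <? t) (z ≟ t) (z ≤? t) <⇒≢ (mk⇔ m≤n⇒m<n∨m≡n [ <⇒≤ , ≤-reflexive ])

  x̄Below+x̄At≡x̄UpTo : ∀ z → x̄Below z + x̄At z ≡ x̄UpTo z
  x̄Below+x̄At≡x̄UpTo z = 𝟙-+-⊎ (N ≤? z + t) (suc (z + t) ≟ N) (N ≤? suc (z + t))
    (λ N≤z+t z+t<N → <⇒≱ (≤-reflexive z+t<N) N≤z+t)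
    (mk⇔ (Sum.map s≤s⁻¹ sym ∘ m≤n⇒m<n∨m≡n) [ m≤n⇒m≤1+n , ≤-reflexive ∘ sym ])

  xBelow+xAt≡xUpTo-pair : ∀ z w → xBelow z + xBelow w + (xAt z + xAt w) ≡ xUpTo z + xUpTo w
  xBelow+xAt≡xUpTo-pair z w =
    trans (+-interchange (xBelow z) (xBelow w) (xAt z) (xAt w))
          (cong₂ _+_ (xBelow+xAt≡xUpTo z) (xBelow+xAt≡xUpTo w))

  x̄Below+x̄At≡x̄UpTo-pair : ∀ z w → x̄Below z + x̄Below w + (x̄At z + x̄At w) ≡ x̄UpTo z + x̄UpTo w
  x̄Below+x̄At≡x̄UpTo-pair z w =
    trans (+-interchange (x̄Below z) (x̄Below w) (x̄At z) (x̄At w))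
          (cong₂ _+_ (x̄Below+x̄At≡x̄UpTo z) (x̄Below+x̄At≡x̄UpTo w))

  -- θ_j, θ'_j, η_j, η'_j for (a, b) ⊗ (a', b') with the common s/2 cancelled: all are ≤ v, resp.
  -- one of them is ≥ v.
  record Bounded (a b a' b' v : ℕ) : Set where
    field
      θ≤  : x̄Below a + x̄Below b ≤ v + (x̄Below a' + x̄Below b')
      θ'≤ : xBelow a' + xBelow b' ≤ v + (xBelow a + xBelow b)
      η≤  : x̄UpTo a + x̄UpTo b ≤ v + (x̄Below a' + x̄Below b' + (xAt a + xAt b))
      η'≤ : xUpTo a' + xUpTo b' ≤ v + (xBelow a + xBelow b + (x̄At a' + x̄At b'))

  data Attains (a b a' b' v : ℕ) : Set where
    θ≥  : v + (x̄Below a' + x̄Below b') ≤ x̄Below a + x̄Below b → Attains a b a' b' v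
    θ'≥ : v + (xBelow a + xBelow b) ≤ xBelow a' + xBelow b' → Attains a b a' b' v
    η≥  : v + (x̄Below a' + x̄Below b' + (xAt a + xAt b)) ≤ x̄UpTo a + x̄UpTo b → Attains a b a' b' v
    η'≥ : v + (xBelow a + xBelow b + (x̄At a' + x̄At b')) ≤ xUpTo a' + xUpTo b' → Attains a b a' b' v

  module _ {a b a' b' : ℕ} where

    bounded-2 : Bounded a b a' b' 2
    bounded-2 = record
      { θ≤  = ≤2+ (x̄Below≤1 a) (x̄Below≤1 b)
      ; θ'≤ = ≤2+ (xUpTo≤1 (suc a')) (xUpTo≤1 (suc b'))
      ; η≤  = ≤2+ (x̄Below≤1 (suc a)) (x̄Below≤1 (suc b))
      ; η'≤ = ≤2+ (xUpTo≤1 a') (xUpTo≤1 b')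
      }
      where
      ≤2+ : ∀ {u w r} → u ≤ 1 → w ≤ 1 → u + w ≤ 2 + r
      ≤2+ {r = r} u≤1 w≤1 = ≤-trans (+-mono-≤ u≤1 w≤1) (m≤m+n 2 r)

    bounded-1 : a < b' → Bounded a b a' b' 1
    bounded-1 a<b' = record
      { θ≤  = ≤1+ʳ (m≤n⇒m≤o+n (x̄Below a') (x̄Below-monotone (<⇒≤ a<b'))) (x̄Below≤1 b)
      ; θ'≤ = +-mono-≤ (xUpTo≤1 (suc a'))
                       (m≤n⇒m≤n+o (xBelow b) (xUpTo-antitone (s≤s (<⇒≤ a<b'))))
      ; η≤  = ≤1+ʳ (m≤n⇒m≤n+o (xAt a + xAt b) (m≤n⇒m≤o+n (x̄Below a') (x̄Below-monotone a<b')))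
                   (x̄Below≤1 (suc b))
      ; η'≤ = +-mono-≤ (xUpTo≤1 a')
                       (m≤n⇒m≤n+o (x̄At a' + x̄At b') (m≤n⇒m≤n+o (xBelow b) (xUpTo-antitone a<b')))
      }
      where
      ≤1+ʳ : ∀ {u w r} → u ≤ r → w ≤ 1 → u + w ≤ 1 + r
      ≤1+ʳ {r = r} u≤r w≤1 = ≤-trans (+-mono-≤ u≤r w≤1) (≤-reflexive (+-comm r 1))

    bounded-0 : a < a' → b < b' → Bounded a b a' b' 0
    bounded-0 a<a' b<b' = record
      { θ≤  = +-mono-≤ (x̄Below-monotone (<⇒≤ a<a')) (x̄Below-monotone (<⇒≤ b<b'))
      ; θ'≤ = +-mono-≤ (xUpTo-antitone (s≤s (<⇒≤ a<a'))) (xUpTo-antitone (s≤s (<⇒≤ b<b')))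
      ; η≤  = m≤n⇒m≤n+o (xAt a + xAt b) (+-mono-≤ (x̄Below-monotone a<a') (x̄Below-monotone b<b'))
      ; η'≤ = m≤n⇒m≤n+o (x̄At a' + x̄At b') (+-mono-≤ (xUpTo-antitone a<a') (xUpTo-antitone b<b'))
      }

    x̄At≡xAt : suc (a + b') ≡ N → x̄At b' ≡ xAt a
    x̄At≡xAt suc[a+b']≡N = 𝟙-cong (suc (b' + t) ≟ N) (a ≟ t) (mk⇔ to from)
      where
      to : suc (b' + t) ≡ N → a ≡ t
      to eq = sym (+-cancelˡ-≡ b' t a
                (trans (suc-injective (trans eq (sym suc[a+b']≡N))) (+-comm a b')))
      from : a ≡ t → suc (b' + t) ≡ N
      from refl = trans (cong suc (+-comm b' a)) suc[a+b']≡N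

    bounded-0-opposite : a ≤ a' → b ≤ b' → a < b' → t < n → suc (a + b') ≡ N → Bounded a b a' b' 0
    bounded-0-opposite a≤a' b≤b' a<b' t<n suc[a+b']≡N = record
      { θ≤  = +-mono-≤ (x̄Below-monotone a≤a') (x̄Below-monotone b≤b')
      ; θ'≤ = +-mono-≤ (xUpTo-antitone (s≤s a≤a')) (xUpTo-antitone (s≤s b≤b'))
      ; η≤  = begin
          x̄UpTo a + x̄UpTo b     ≡⟨ cong (_+ x̄UpTo b) (x̄Below≡0 (suc+<N a<n t<n)) ⟩
          x̄UpTo b               ≤⟨ x̄Below-monotone (s≤s b≤b') ⟩
          x̄UpTo b'              ≡⟨ sym (x̄Below+x̄At≡x̄UpTo b') ⟩
          x̄Below b' + x̄At b'    ≡⟨ cong (x̄Below b' +_) (x̄At≡xAt suc[a+b']≡N) ⟩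
          x̄Below b' + xAt a     ≤⟨ +-mono-≤ (m≤n+m (x̄Below b') (x̄Below a')) (m≤m+n (xAt a) (xAt b)) ⟩
          x̄Below a' + x̄Below b' + (xAt a + xAt b) ∎
      ; η'≤ = begin
          xUpTo a' + xUpTo b'   ≡⟨ cong (xUpTo a' +_) (xUpTo≡0 (<-≤-trans t<n n≤b')) ⟩
          xUpTo a' + 0          ≡⟨ +-identityʳ (xUpTo a') ⟩
          xUpTo a'              ≤⟨ xUpTo-antitone a≤a' ⟩
          xUpTo a               ≡⟨ sym (xBelow+xAt≡xUpTo a) ⟩
          xBelow a + xAt a      ≡⟨ cong (xBelow a +_) (sym (x̄At≡xAt suc[a+b']≡N)) ⟩
          xBelow a + x̄At b'     ≤⟨ +-mono-≤ (m≤m+n (xBelow a) (xBelow b)) (m≤n+m (x̄At b') (x̄At a')) ⟩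
          xBelow a + xBelow b + (x̄At a' + x̄At b') ∎
      }
      where
      open ≤-Reasoning
      a<n : a < n
      a<n = opposite⇒<n a<b' suc[a+b']≡N
      n≤b' : n ≤ b'
      n≤b' = opposite⇒n≤ a<b' suc[a+b']≡N

  attains-2-at-barred-y' : ∀ {a b a' b'} → a' ≤ b' → b' ≤ a → a ≤ b → t < n → n ≤ b' →
                           suc (b' + t) ≡ N → Attains a b a' b' 2
  attains-2-at-barred-y' {a} {b} {a'} {b'} a'≤b' b'≤a a≤b t<n n≤b' y'-at-t = η≥ η≥2
    where
    open AtBarred y'-at-t
    η≥2 : 2 + (x̄Below a' + x̄Below b' + (xAt a + xAt b)) ≤ x̄UpTo a + x̄UpTo b
    η≥2 rewrite ≥⇒x̄UpTo≡1 b'≤a | ≥⇒x̄UpTo≡1 (≤-trans b'≤a a≤b)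
              | ≤⇒x̄Below≡0 a'≤b' | ≤⇒x̄Below≡0 (≤-refl {b'})
              | xAt≡0-barred t<n (≤-trans n≤b' b'≤a) | xAt≡0-barred t<n (≤-trans n≤b' (≤-trans b'≤a a≤b))
              = ≤-refl

  attains-2-at-unbarred-y' : ∀ {a b a'} → a' ≤ t → t ≤ a → a ≤ b → t < n → Attains a b a' t 2
  attains-2-at-unbarred-y' {a} {b} {a'} a'≤t t≤a a≤b t<n = η'≥ η'≥2
    where
    η'≥2 : 2 + (xBelow a + xBelow b + (x̄At a' + x̄At t)) ≤ xUpTo a' + xUpTo t
    η'≥2 rewrite xUpTo≡1 a'≤t | xUpTo≡1 (≤-refl {t})
               | xUpTo≡0 {suc a} (s≤s t≤a) | xUpTo≡0 {suc b} (s≤s (≤-trans t≤a a≤b))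
               | x̄At≡0-unbarred {a'} t<n (≤-<-trans a'≤t t<n) | x̄At≡0-unbarred {t} t<n t<n
               = ≤-refl

  attains-1-at-barred-y' : ∀ {a b a' b'} → a < b' → b' ≤ b → a' ≤ b' → t < n → n ≤ b' →
                           suc (a + b') ≢ N → suc (b' + t) ≡ N → Attains a b a' b' 1
  attains-1-at-barred-y' {a} {b} {a'} {b'} a<b' b'≤b a'≤b' t<n n≤b' suc[a+b']≢N y'-at-t = η≥ η≥1
    where
    open AtBarred y'-at-t
    η≥1 : 1 + (x̄Below a' + x̄Below b' + (xAt a + xAt b)) ≤ x̄UpTo a + x̄UpTo b
    η≥1 rewrite <⇒x̄UpTo≡0 a<b' | ≥⇒x̄UpTo≡1 b'≤b
              | ≤⇒x̄Below≡0 a'≤b' | ≤⇒x̄Below≡0 (≤-refl {b'})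
              | xAt≡0 {a} (λ { refl → suc[a+b']≢N (trans (cong suc (+-comm a b')) y'-at-t) })
              | xAt≡0-barred t<n (≤-trans n≤b' b'≤b)
              = ≤-refl

  attains-1-at-unbarred-y' : ∀ {a b a'} → a < t → t ≤ b → a' ≤ t → t < n → Attains a b a' t 1
  attains-1-at-unbarred-y' {a} {b} {a'} a<t t≤b a'≤t t<n = η'≥ η'≥1
    where
    η'≥1 : 1 + (xBelow a + xBelow b + (x̄At a' + x̄At t)) ≤ xUpTo a' + xUpTo t
    η'≥1 rewrite xUpTo≡1 a'≤t | xUpTo≡1 (≤-refl {t})
               | xUpTo≡1 {suc a} a<t | xUpTo≡0 {suc b} (s≤s t≤b)
               | x̄At≡0-unbarred {a'} t<n (≤-<-trans a'≤t t<n) | x̄At≡0-unbarred {t} t<n t<n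
               = ≤-refl

  attains-1-at-barred-x : ∀ {a b a' b'} → a' ≤ a → a < b' → a ≤ b → t < n → n ≤ a →
                          suc (a + t) ≡ N → Attains a b a' b' 1
  attains-1-at-barred-x {a} {b} {a'} {b'} a'≤a a<b' a≤b t<n n≤a x-at-t = η≥ η≥1
    where
    open AtBarred x-at-t
    η≥1 : 1 + (x̄Below a' + x̄Below b' + (xAt a + xAt b)) ≤ x̄UpTo a + x̄UpTo b
    η≥1 rewrite ≥⇒x̄UpTo≡1 (≤-refl {a}) | ≥⇒x̄UpTo≡1 a≤b
              | ≤⇒x̄Below≡0 a'≤a | >⇒x̄Below≡1 a<b'
              | xAt≡0-barred t<n n≤a | xAt≡0-barred t<n (≤-trans n≤a a≤b)
              = ≤-refl

  attains-1-at-unbarred-x : ∀ {b a' b'} → a' ≤ t → t < b' → t ≤ b → t < n →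
                            suc (t + b') ≢ N → Attains t b a' b' 1
  attains-1-at-unbarred-x {b} {a'} {b'} a'≤t t<b' t≤b t<n suc[t+b']≢N = η'≥ η'≥1
    where
    η'≥1 : 1 + (xBelow t + xBelow b + (x̄At a' + x̄At b')) ≤ xUpTo a' + xUpTo b'
    η'≥1 rewrite xUpTo≡1 a'≤t | xUpTo≡0 t<b'
               | xUpTo≡0 {suc t} ≤-refl | xUpTo≡0 {suc b} (s≤s t≤b)
               | x̄At≡0-unbarred {a'} t<n (≤-<-trans a'≤t t<n)
               | x̄At≡0 {b'} (suc[t+b']≢N ∘ trans (cong suc (+-comm t b')))
               = ≤-refl

  attains-1-at-x-opposite : ∀ {b a' b'} → a' < t → t < b' → t ≤ b → Attains t b a' b' 1
  attains-1-at-x-opposite {b} {a'} {b'} a'<t t<b' t≤b = θ'≥ θ'≥1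
    where
    θ'≥1 : 1 + (xBelow t + xBelow b) ≤ xBelow a' + xBelow b'
    θ'≥1 rewrite xUpTo≡1 {suc a'} a'<t | xUpTo≡0 {suc b'} (s≤s (<⇒≤ t<b'))
               | xUpTo≡0 {suc t} ≤-refl | xUpTo≡0 {suc b} (s≤s t≤b)
               = ≤-refl

  attains-1-at-y'-opposite : ∀ {a b a' b'} → a < b' → b' < b → a' ≤ b' → suc (b' + t) ≡ N →
                             Attains a b a' b' 1
  attains-1-at-y'-opposite {a} {b} {a'} {b'} a<b' b'<b a'≤b' y'-at-t = θ≥ θ≥1
    where
    open AtBarred y'-at-t
    θ≥1 : 1 + (x̄Below a' + x̄Below b') ≤ x̄Below a + x̄Below b
    θ≥1 rewrite >⇒x̄Below≡1 b'<b | ≤⇒x̄Below≡0 (<⇒≤ a<b')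
              | ≤⇒x̄Below≡0 a'≤b' | ≤⇒x̄Below≡0 (≤-refl {b'})
              = ≤-refl

module Energy (n : ℕ) where
  open import Data.Nat using (_+_; _≤_; _<_; z≤n)
  open import Data.Nat.Properties using (<-trans)
  open import Data.Product using (∃; _×_; _,_)
  open import Data.Sum using (_⊎_; inj₁; inj₂)
  open Positions n
  open Thresholds n

  record HasEnergy (a b a' b' v : ℕ) : Set where
    field
      bounded  : ∀ t → t < n → Bounded t a b a' b' v
      attained : ∃ λ t → t < n × Attains t a b a' b' v

  -- At the threshold 0, xBelow z = [z + 1 ≤ 0] vanishes by computation.
  attains-0 : ∀ {a b a' b'} → Attains 0 a b a' b' 0
  attains-0 = θ'≥ z≤n

  module Values {a b a' b' : ℕ} (a≤b : a ≤ b) (a'≤b' : a' ≤ b') (b'<N : b' < N) where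

    energy-2 : b' ≤ a → HasEnergy a b a' b' 2
    energy-2 b'≤a = record { bounded = λ t _ → bounded-2 t ; attained = at-y' (letterIndex b'<N) }
      where
      at-y' : LetterIndex b' → ∃ λ t → t < n × Attains t a b a' b' 2
      at-y' (unbarred-letter b'<n) =
        b' , b'<n , attains-2-at-unbarred-y' b' a'≤b' b'≤a a≤b b'<n
      at-y' (barred-letter t t<n n≤b' y'-at-t) =
        t , t<n , attains-2-at-barred-y' t a'≤b' b'≤a a≤b t<n n≤b' y'-at-t

    energy-1 : a < b' → suc (a + b') ≢ N → a' ≤ a ⊎ b' ≤ b → HasEnergy a b a' b' 1
    energy-1 a<b' suc[a+b']≢N a'≤a⊎b'≤b =
      record { bounded = λ t _ → bounded-1 t a<b' ; attained = at a'≤a⊎b'≤b }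
      where
      at : a' ≤ a ⊎ b' ≤ b → ∃ λ t → t < n × Attains t a b a' b' 1
      at (inj₁ a'≤a) with letterIndex (<-trans a<b' b'<N)
      ... | unbarred-letter a<n =
        a , a<n , attains-1-at-unbarred-x a a'≤a a<b' a≤b a<n suc[a+b']≢N
      ... | barred-letter t t<n n≤a x-at-t =
        t , t<n , attains-1-at-barred-x t a'≤a a<b' a≤b t<n n≤a x-at-t
      at (inj₂ b'≤b) with letterIndex b'<N
      ... | unbarred-letter b'<n =
        b' , b'<n , attains-1-at-unbarred-y' b' a<b' b'≤b a'≤b' b'<n
      ... | barred-letter t t<n n≤b' y'-at-t =
        t , t<n , attains-1-at-barred-y' t a<b' b'≤b a'≤b' t<n n≤b' suc[a+b']≢N y'-at-t

    energy-0 : a < a' → b < b' → 0 < n → HasEnergy a b a' b' 0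
    energy-0 a<a' b<b' 0<n =
      record { bounded = λ t _ → bounded-0 t a<a' b<b' ; attained = 0 , 0<n , attains-0 }

    energy-1-opposite : a < b' → suc (a + b') ≡ N → a' < a ⊎ b' < b → HasEnergy a b a' b' 1
    energy-1-opposite a<b' suc[a+b']≡N a'<a⊎b'<b =
      record { bounded = λ t _ → bounded-1 t a<b' ; attained = at a'<a⊎b'<b }
      where
      at : a' < a ⊎ b' < b → ∃ λ t → t < n × Attains t a b a' b' 1
      at (inj₁ a'<a) =
        a , opposite⇒<n a<b' suc[a+b']≡N , attains-1-at-x-opposite a a'<a a<b' a≤b
      at (inj₂ b'<b) with barred-index (opposite⇒n≤ a<b' suc[a+b']≡N) b'<N
      ... | t , t<n , y'-at-t = t , t<n , attains-1-at-y'-opposite t a<b' b'<b a'≤b' y'-at-t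

    energy-0-opposite : a ≤ a' → b ≤ b' → a < b' → suc (a + b') ≡ N → 0 < n → HasEnergy a b a' b' 0
    energy-0-opposite a≤a' b≤b' a<b' suc[a+b']≡N 0<n = record
      { bounded  = λ t t<n → bounded-0-opposite t a≤a' b≤b' a<b' t<n suc[a+b']≡N
      ; attained = 0 , 0<n , attains-0
      }

module _ where
  open import Data.Integer using (ℤ; +_; _+_; _-_; -_; _≤_; _⊔_; +≤+)
  open import Data.Integer.Properties
    using (≤-trans; ≤-reflexive; ≤-antisym; +-monoˡ-≤; ⊔-lub; i≤j⇒i≤j⊔k; i≤j⇒i≤k⊔j)
  import Data.Nat as ℕ
  open import Data.Fin using (zero; suc)
  open import Data.Vec using (foldr₁; tabulate)
  open import Data.Product using (∃; _,_)
  open import Data.Sum using (_⊎_; inj₁; inj₂)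

  diff≤ : ∀ {i p q v} → i ≡ + p - + q → p ℕ.≤ v ℕ.+ q → i ≤ + v
  diff≤ {q = q} {v} refl p≤v+q =
    ≤-trans (+-monoˡ-≤ (- + q) (+≤+ p≤v+q)) (≤-reflexive (i+j-j≡i (+ v) (+ q)))

  ≤diff : ∀ {i p q v} → i ≡ + p - + q → v ℕ.+ q ℕ.≤ p → + v ≤ i
  ≤diff {q = q} {v} refl v+q≤p =
    ≤-trans (≤-reflexive (sym (i+j-j≡i (+ v) (+ q)))) (+-monoˡ-≤ (- + q) (+≤+ v+q≤p))

  foldr₁-⊔-≤ : ∀ {m} (f : Fin (suc m) → ℤ) {v} → (∀ j → f j ≤ v) → foldr₁ _⊔_ (tabulate f) ≤ v
  foldr₁-⊔-≤ {ℕ.zero}  f f≤v = f≤v zero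
  foldr₁-⊔-≤ {ℕ.suc m} f f≤v = ⊔-lub (f≤v zero) (foldr₁-⊔-≤ (f ∘ suc) (f≤v ∘ suc))

  ≤-foldr₁-⊔ : ∀ {m} (f : Fin (suc m) → ℤ) (j : Fin (suc m)) {v} →
               v ≤ f j → v ≤ foldr₁ _⊔_ (tabulate f)
  ≤-foldr₁-⊔ {ℕ.zero}  f zero    v≤fj = v≤fj
  ≤-foldr₁-⊔ {ℕ.suc m} f zero    v≤fj = i≤j⇒i≤j⊔k _ v≤fj
  ≤-foldr₁-⊔ {ℕ.suc m} f (suc j) v≤fj = i≤j⇒i≤k⊔j _ (≤-foldr₁-⊔ (f ∘ suc) j v≤fj)

  module _ {n : ℕ} (b b' : Crystal n) (j : Fin n) where

    energyTerms : ℤ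
    energyTerms = θ b b' j ⊔ θ' b b' j ⊔ η b b' j ⊔ η' b b' j

    energyTerms-≤ : ∀ {v} → θ b b' j ≤ v → θ' b b' j ≤ v → η b b' j ≤ v → η' b b' j ≤ v →
                    energyTerms ≤ v
    energyTerms-≤ θ≤v θ'≤v η≤v η'≤v = ⊔-lub (⊔-lub (⊔-lub θ≤v θ'≤v) η≤v) η'≤v

    ≤-energyTerms : ∀ {v} → v ≤ θ b b' j ⊎ v ≤ θ' b b' j ⊎ v ≤ η b b' j ⊎ v ≤ η' b b' j →
                    v ≤ energyTerms
    ≤-energyTerms (inj₁ v≤θ)                = i≤j⇒i≤j⊔k _ (i≤j⇒i≤j⊔k _ (i≤j⇒i≤j⊔k _ v≤θ))
    ≤-energyTerms (inj₂ (inj₁ v≤θ'))        = i≤j⇒i≤j⊔k _ (i≤j⇒i≤j⊔k _ (i≤j⇒i≤k⊔j _ v≤θ'))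
    ≤-energyTerms (inj₂ (inj₂ (inj₁ v≤η)))  = i≤j⇒i≤j⊔k _ (i≤j⇒i≤k⊔j _ v≤η)
    ≤-energyTerms (inj₂ (inj₂ (inj₂ v≤η'))) = i≤j⇒i≤k⊔j _ v≤η'

  H-≡ : ∀ {m} (b b' : Crystal (suc m)) {v} →
        (∀ j → energyTerms b b' j ≤ v) → (∃ λ j → v ≤ energyTerms b b' j) → H b b' ≡ v
  H-≡ b b' bounded (j , attained) =
    ≤-antisym (foldr₁-⊔-≤ (energyTerms b b') bounded) (≤-foldr₁-⊔ (energyTerms b b') j attained)

module _ {n : ℕ} where
  open import Data.Integer using (+_; _+_; _-_; _≤_)
  open import Data.Nat.DivMod using (_/_)
  import Data.Nat as ℕ

  barredBelow unbarredBelow : Crystal n → Fin n → ℕ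
  barredBelow b j = sumℕ (map (λ k → vec b (barred k)) (below j))
  unbarredBelow b j = sumℕ (map (λ k → vec b (unbar k)) (below j))

  half : Crystal n → ℕ
  half b = s b / 2

  private
    [X-X']+[h'-h] : ∀ X X' h h' → (+ X - + X') + (+ h' - + h) ≡ + (X ℕ.+ h') - + (X' ℕ.+ h)
    [X-X']+[h'-h] X X' h h' = [i-j]+[k-l]≡[i+k]-[j+l] (+ X) (+ X') (+ h') (+ h)

  module _ (b b' : Crystal n) (j : Fin n) where

    θ≡ : θ b b' j ≡ + (barredBelow b j ℕ.+ half b') - + (barredBelow b' j ℕ.+ half b)
    θ≡ = trans (cong (_+ halfDiff b b')
                     (sumℤ-map-- (λ k → vec b (barred k)) (λ k → vec b' (barred k)) (below j)))
               ([X-X']+[h'-h] (barredBelow b j) (barredBelow b' j) (half b) (half b'))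

    θ'≡ : θ' b b' j ≡ + (unbarredBelow b' j ℕ.+ half b) - + (unbarredBelow b j ℕ.+ half b')
    θ'≡ = trans (cong (_+ halfDiff b' b)
                      (sumℤ-map-- (λ k → vec b' (unbar k)) (λ k → vec b (unbar k)) (below j)))
                ([X-X']+[h'-h] (unbarredBelow b' j) (unbarredBelow b j) (half b') (half b))

    η≡ : η b b' j ≡ + (barredBelow b j ℕ.+ vec b (barred j) ℕ.+ half b')
                    - + (barredBelow b' j ℕ.+ vec b (unbar j) ℕ.+ half b)
    η≡ = trans (cong (λ i → i + (xbc b j - xc b j) + halfDiff b b')
                     (sumℤ-map-- (λ k → vec b (barred k)) (λ k → vec b' (barred k)) (below j)))
               ([i-j]+[k-l]+[m-o]≡[i+k+m]-[j+l+o] (+ barredBelow b j) (+ barredBelow b' j)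
                  (+ vec b (barred j)) (+ vec b (unbar j)) (+ half b') (+ half b))

    η'≡ : η' b b' j ≡ + (unbarredBelow b' j ℕ.+ vec b' (unbar j) ℕ.+ half b)
                     - + (unbarredBelow b j ℕ.+ vec b' (barred j) ℕ.+ half b')
    η'≡ = trans (cong (λ i → i + (xc b' j - xbc b' j) + halfDiff b' b)
                      (sumℤ-map-- (λ k → vec b' (unbar k)) (λ k → vec b (unbar k)) (below j)))
                ([i-j]+[k-l]+[m-o]≡[i+k+m]-[j+l+o] (+ unbarredBelow b' j) (+ unbarredBelow b j)
                   (+ vec b' (unbar j)) (+ vec b' (barred j)) (+ half b) (+ half b'))

    module _ {v : ℕ} where

      θ-≤ : barredBelow b j ℕ.+ half b' ℕ.≤ v ℕ.+ (barredBelow b' j ℕ.+ half b) → θ b b' j ≤ + v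
      θ-≤ = diff≤ θ≡

      θ'-≤ : unbarredBelow b' j ℕ.+ half b ℕ.≤ v ℕ.+ (unbarredBelow b j ℕ.+ half b') → θ' b b' j ≤ + v
      θ'-≤ = diff≤ θ'≡

      η-≤ : barredBelow b j ℕ.+ vec b (barred j) ℕ.+ half b'
              ℕ.≤ v ℕ.+ (barredBelow b' j ℕ.+ vec b (unbar j) ℕ.+ half b) → η b b' j ≤ + v
      η-≤ = diff≤ η≡

      η'-≤ : unbarredBelow b' j ℕ.+ vec b' (unbar j) ℕ.+ half b
               ℕ.≤ v ℕ.+ (unbarredBelow b j ℕ.+ vec b' (barred j) ℕ.+ half b') → η' b b' j ≤ + v
      η'-≤ = diff≤ η'≡

      θ-≥ : v ℕ.+ (barredBelow b' j ℕ.+ half b) ℕ.≤ barredBelow b j ℕ.+ half b' → + v ≤ θ b b' j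
      θ-≥ = ≤diff θ≡

      θ'-≥ : v ℕ.+ (unbarredBelow b j ℕ.+ half b') ℕ.≤ unbarredBelow b' j ℕ.+ half b → + v ≤ θ' b b' j
      θ'-≥ = ≤diff θ'≡

  half-pr : (x y : Letter n) (p : x Fin.≤ y) → half (pr x y p) ≡ 1
  half-pr x y p = cong (_/ 2) (s-pr {n} x y p)

  half-∅ : half ∅c ≡ 0
  half-∅ = cong (_/ 2) (s-∅ {n})

  module _ (j : Fin n) where
    open Thresholds n (toℕ j)

    barredBelow-∅ : barredBelow ∅c j ≡ 0
    barredBelow-∅ = sum-map-0 (below j)

    unbarredBelow-∅ : unbarredBelow ∅c j ≡ 0
    unbarredBelow-∅ = sum-map-0 (below j)

    module _ (x y : Letter n) (p : x Fin.≤ y) where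

      barredBelow-pr : barredBelow (pr x y p) j ≡ x̄Below (toℕ x) ℕ.+ x̄Below (toℕ y)
      barredBelow-pr =
        trans (sum-map-+ (λ k → e {n} x (barred k)) (λ k → e {n} y (barred k)) (below j))
              (cong₂ ℕ._+_ (count-barred x j) (count-barred y j))

      unbarredBelow-pr : unbarredBelow (pr x y p) j ≡ xBelow (toℕ x) ℕ.+ xBelow (toℕ y)
      unbarredBelow-pr =
        trans (sum-map-+ (λ k → e {n} x (unbar k)) (λ k → e {n} y (unbar k)) (below j))
              (cong₂ ℕ._+_ (count-unbarred x j) (count-unbarred y j))

      vec-pr-unbar : vec {n} (pr x y p) (unbar j) ≡ xAt (toℕ x) ℕ.+ xAt (toℕ y)
      vec-pr-unbar = cong₂ ℕ._+_ (e-unbar x j) (e-unbar y j)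

      vec-pr-barred : vec {n} (pr x y p) (barred j) ≡ x̄At (toℕ x) ℕ.+ x̄At (toℕ y)
      vec-pr-barred = cong₂ ℕ._+_ (e-barred x j) (e-barred y j)

module _ {m : ℕ} where
  open import Data.Integer using (+_; _≤_)
  import Data.Nat as ℕ
  open import Data.Nat.Properties using (+-identityʳ; +-mono-≤; m≤m+n; m≤n+m; ≤-trans; ≤-refl)
  open import Data.Fin using (zero)
  open import Data.Fin.Properties using (toℕ<n)
  open import Data.Product using (_,_)
  open import Data.Sum using (inj₁; inj₂)

  private
    n : ℕ
    n = suc m
    ∅ : Crystal n
    ∅ = ∅c

  H-∅-∅ : H ∅ ∅ ≡ + 0
  H-∅-∅ = H-≡ ∅ ∅
    (λ j → energyTerms-≤ ∅ ∅ j (θ-≤ ∅ ∅ j ≤-refl) (θ'-≤ ∅ ∅ j ≤-refl)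
                               (η-≤ ∅ ∅ j ≤-refl) (η'-≤ ∅ ∅ j ≤-refl))
    (zero , ≤-energyTerms ∅ ∅ zero (inj₁ (θ-≥ ∅ ∅ zero ≤-refl)))

  module _ (x y : Letter n) (p : x Fin.≤ y) where
    private
      B : Crystal n
      B = pr x y p
      a b : ℕ
      a = toℕ x
      b = toℕ y
      half-B : half B ≡ 1
      half-B = half-pr {n} x y p
      half-∅′ : half ∅ ≡ 0
      half-∅′ = half-∅ {n}
      ≤-subst : ∀ {u u' w w'} → u ≡ u' → w ≡ w' → u' ℕ.≤ w' → u ℕ.≤ w
      ≤-subst refl refl u'≤w' = u'≤w'
      pair≤2 : ∀ {u w} → u ℕ.≤ 1 → w ℕ.≤ 1 → u ℕ.+ w ℕ.+ 0 ℕ.≤ 2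
      pair≤2 {u} {w} u≤1 w≤1 = ≤-subst (+-identityʳ (u ℕ.+ w)) refl (+-mono-≤ u≤1 w≤1)

    energyTerms-∅-pr : ∀ j → energyTerms ∅ B j ≤ + 1
    energyTerms-∅-pr j = energyTerms-≤ ∅ B j θ≤1 θ'≤1 η≤1 η'≤1
      where
      open Thresholds n (toℕ j)
      θ≤1 : θ ∅ B j ≤ + 1
      θ≤1 = θ-≤ ∅ B j (≤-subst (cong₂ ℕ._+_ (barredBelow-∅ j) half-B) refl (m≤m+n 1 _))
      θ'≤1 : θ' ∅ B j ≤ + 1
      θ'≤1 = θ'-≤ ∅ B j (≤-subst (cong₂ ℕ._+_ (unbarredBelow-pr j x y p) half-∅′)
                                 (cong (1 ℕ.+_) (cong₂ ℕ._+_ (unbarredBelow-∅ j) half-B))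
                                 (pair≤2 (xUpTo≤1 (suc a)) (xUpTo≤1 (suc b))))
      η≤1 : η ∅ B j ≤ + 1
      η≤1 = η-≤ ∅ B j
        (≤-subst (cong₂ ℕ._+_ (cong (ℕ._+ 0) (barredBelow-∅ j)) half-B) refl (m≤m+n 1 _))
      η'≤1 : η' ∅ B j ≤ + 1
      η'≤1 = η'-≤ ∅ B j (≤-subst
        (cong₂ ℕ._+_ (trans (cong₂ ℕ._+_ (unbarredBelow-pr j x y p) (vec-pr-unbar j x y p))
                            (xBelow+xAt≡xUpTo-pair a b))
                     half-∅′)
        (cong (λ h → 1 ℕ.+ (unbarredBelow ∅ j ℕ.+ vec B (barred j) ℕ.+ h)) half-B)
        (≤-trans (pair≤2 (xUpTo≤1 a) (xUpTo≤1 b)) (ℕ.s≤s (m≤n+m 1 _))))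

    energyTerms-pr-∅ : ∀ j → energyTerms B ∅ j ≤ + 1
    energyTerms-pr-∅ j = energyTerms-≤ B ∅ j θ≤1 θ'≤1 η≤1 η'≤1
      where
      open Thresholds n (toℕ j)
      θ≤1 : θ B ∅ j ≤ + 1
      θ≤1 = θ-≤ B ∅ j (≤-subst (cong₂ ℕ._+_ (barredBelow-pr j x y p) half-∅′)
                               (cong (1 ℕ.+_) (cong₂ ℕ._+_ (barredBelow-∅ j) half-B))
                               (pair≤2 (x̄Below≤1 a) (x̄Below≤1 b)))
      θ'≤1 : θ' B ∅ j ≤ + 1
      θ'≤1 = θ'-≤ B ∅ j (≤-subst (cong₂ ℕ._+_ (unbarredBelow-∅ j) half-B) refl (m≤m+n 1 _))
      η≤1 : η B ∅ j ≤ + 1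
      η≤1 = η-≤ B ∅ j (≤-subst
        (cong₂ ℕ._+_ (trans (cong₂ ℕ._+_ (barredBelow-pr j x y p) (vec-pr-barred j x y p))
                            (x̄Below+x̄At≡x̄UpTo-pair a b))
                     half-∅′)
        (cong (λ h → 1 ℕ.+ (barredBelow ∅ j ℕ.+ vec B (unbar j) ℕ.+ h)) half-B)
        (≤-trans (pair≤2 (x̄Below≤1 (suc a)) (x̄Below≤1 (suc b))) (ℕ.s≤s (m≤n+m 1 _))))
      η'≤1 : η' B ∅ j ≤ + 1
      η'≤1 = η'-≤ B ∅ j
        (≤-subst (cong₂ ℕ._+_ (cong (ℕ._+ 0) (unbarredBelow-∅ j)) half-B) refl (m≤m+n 1 _))

    H-∅-pr : H ∅ B ≡ + 1
    H-∅-pr = H-≡ ∅ B energyTerms-∅-pr (zero , ≤-energyTerms ∅ B zero (inj₁ (θ-≥ ∅ B zero θ≥1)))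
      where
      open Thresholds n 0 using (x̄Below; x̄Below≡0)
      x̄Below≡0-at-0 : (z : Letter n) → x̄Below (toℕ z) ≡ 0
      x̄Below≡0-at-0 z = x̄Below≡0 (subst (ℕ._< n ℕ.+ n) (sym (+-identityʳ (toℕ z))) (toℕ<n z))
      θ≥1 : 1 ℕ.+ (barredBelow B zero ℕ.+ half ∅) ℕ.≤ barredBelow ∅ zero ℕ.+ half B
      θ≥1 = ≤-subst (cong₂ (λ u h → 1 ℕ.+ (u ℕ.+ h))
                           (trans (barredBelow-pr zero x y p)
                                  (cong₂ ℕ._+_ (x̄Below≡0-at-0 x) (x̄Below≡0-at-0 y)))
                           half-∅′)
                    (cong₂ ℕ._+_ (barredBelow-∅ {n} zero) half-B)
                    ≤-refl

    H-pr-∅ : H B ∅ ≡ + 1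
    H-pr-∅ = H-≡ B ∅ energyTerms-pr-∅ (zero , ≤-energyTerms B ∅ zero (inj₂ (inj₁ (θ'-≥ B ∅ zero θ'≥1))))
      where
      θ'≥1 : 1 ℕ.+ (unbarredBelow B zero ℕ.+ half ∅) ℕ.≤ unbarredBelow ∅ zero ℕ.+ half B
      θ'≥1 = ≤-subst (cong₂ (λ u h → 1 ℕ.+ (u ℕ.+ h)) (unbarredBelow-pr zero x y p) half-∅′)
                     (cong₂ ℕ._+_ (unbarredBelow-∅ {n} zero) half-B)
                     ≤-refl

module _ {n : ℕ} {x y x' y' : Letter n} (p : x Fin.≤ y) (p' : x' Fin.≤ y') (j : Fin n) where
  open import Data.Integer using (+_; _-_)
  import Data.Nat as ℕ
  open Thresholds n (toℕ j)

  private
    a b a' b' : ℕ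
    a = toℕ x
    b = toℕ y
    a' = toℕ x'
    b' = toℕ y'
    B B' : Crystal n
    B = pr x y p
    B' = pr x' y' p'

    drop-halves : ∀ {X X' Y Y' h h'} → h ≡ 1 → h' ≡ 1 → X ≡ Y → X' ≡ Y' →
                  + (X ℕ.+ h) - + (X' ℕ.+ h') ≡ + Y - + Y'
    drop-halves {X} {X'} refl refl refl refl = [i+k]-[j+k]≡i-j (+ X) (+ X') (+ 1)

  θ-pr-pr : θ B B' j ≡ + (x̄Below a ℕ.+ x̄Below b) - + (x̄Below a' ℕ.+ x̄Below b')
  θ-pr-pr = trans (θ≡ B B' j)
    (drop-halves (half-pr {n} x' y' p') (half-pr {n} x y p)
                 (barredBelow-pr j x y p) (barredBelow-pr j x' y' p'))

  θ'-pr-pr : θ' B B' j ≡ + (xBelow a' ℕ.+ xBelow b') - + (xBelow a ℕ.+ xBelow b)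
  θ'-pr-pr = trans (θ'≡ B B' j)
    (drop-halves (half-pr {n} x y p) (half-pr {n} x' y' p')
                 (unbarredBelow-pr j x' y' p') (unbarredBelow-pr j x y p))

  η-pr-pr : η B B' j ≡ + (x̄UpTo a ℕ.+ x̄UpTo b) - + (x̄Below a' ℕ.+ x̄Below b' ℕ.+ (xAt a ℕ.+ xAt b))
  η-pr-pr = trans (η≡ B B' j) (drop-halves (half-pr {n} x' y' p') (half-pr {n} x y p)
    (trans (cong₂ ℕ._+_ (barredBelow-pr j x y p) (vec-pr-barred j x y p)) (x̄Below+x̄At≡x̄UpTo-pair a b))
    (cong₂ ℕ._+_ (barredBelow-pr j x' y' p') (vec-pr-unbar j x y p)))

  η'-pr-pr : η' B B' j ≡ + (xUpTo a' ℕ.+ xUpTo b') - + (xBelow a ℕ.+ xBelow b ℕ.+ (x̄At a' ℕ.+ x̄At b'))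
  η'-pr-pr = trans (η'≡ B B' j) (drop-halves (half-pr {n} x y p) (half-pr {n} x' y' p')
    (trans (cong₂ ℕ._+_ (unbarredBelow-pr j x' y' p') (vec-pr-unbar j x' y' p'))
           (xBelow+xAt≡xUpTo-pair a' b'))
    (cong₂ ℕ._+_ (unbarredBelow-pr j x y p) (vec-pr-barred j x' y' p')))

module _ {m : ℕ} {x y x' y' : Letter (suc m)} (p : x Fin.≤ y) (p' : x' Fin.≤ y') where
  open import Data.Nat using (_<_)
  open import Data.Integer using (+_; _≤_)
  open import Data.Fin using (fromℕ<)
  open import Data.Fin.Properties using (toℕ<n; toℕ-fromℕ<)
  open import Data.Product using (∃; _×_; _,_)
  open import Data.Sum using (inj₁; inj₂)
  open Energy (suc m) using (HasEnergy)
  open Thresholds (suc m) using (Attains; θ≥; θ'≥; η≥; η'≥)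

  private
    a b a' b' : ℕ
    a = toℕ x
    b = toℕ y
    a' = toℕ x'
    b' = toℕ y'
    B B' : Crystal (suc m)
    B = pr x y p
    B' = pr x' y' p'

  H-pr-pr : ∀ {v} → HasEnergy a b a' b' v → H B B' ≡ + v
  H-pr-pr {v} E = H-≡ B B' bounded (attained (HasEnergy.attained E))
    where
    bounded : ∀ j → energyTerms B B' j ≤ + v
    bounded j = energyTerms-≤ B B' j (diff≤ (θ-pr-pr p p' j) θ≤) (diff≤ (θ'-pr-pr p p' j) θ'≤)
                                     (diff≤ (η-pr-pr p p' j) η≤) (diff≤ (η'-pr-pr p p' j) η'≤)
      where open Thresholds.Bounded (HasEnergy.bounded E (toℕ j) (toℕ<n j))
    at : ∀ j → Attains (toℕ j) a b a' b' v → + v ≤ energyTerms B B' j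
    at j (θ≥ h)  = ≤-energyTerms B B' j (inj₁ (≤diff (θ-pr-pr p p' j) h))
    at j (θ'≥ h) = ≤-energyTerms B B' j (inj₂ (inj₁ (≤diff (θ'-pr-pr p p' j) h)))
    at j (η≥ h)  = ≤-energyTerms B B' j (inj₂ (inj₂ (inj₁ (≤diff (η-pr-pr p p' j) h))))
    at j (η'≥ h) = ≤-energyTerms B B' j (inj₂ (inj₂ (inj₂ (≤diff (η'-pr-pr p p' j) h))))
    attained : ∃ (λ t → t < suc m × Attains t a b a' b' v) → ∃ λ j → + v ≤ energyTerms B B' j
    attained (t , t<n , attains) =
      fromℕ< t<n , at (fromℕ< t<n) (subst (λ t → Attains t a b a' b' v) (sym (toℕ-fromℕ< t<n)) attains)

module _ {m : ℕ} (x y x' y' : Letter (suc m)) (p : x Fin.≤ y) (p' : x' Fin.≤ y') where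
  open import Data.Nat using (_+_; _≤_; _<_; z≤n; s≤s)
  open import Data.Nat.Properties using (≤-trans; ≤-<-trans; <-≤-trans; ≮⇒≥; ≰⇒>; ≤∧≢⇒<)
  open import Data.Integer using (+_) renaming (_+_ to _+ℤ_; _-_ to _-ℤ_)
  open import Data.Fin using (_≤?_; _<?_)
  open import Data.Fin.Properties using (toℕ<n)
  open import Data.Sum using (inj₁; inj₂)
  open import Relation.Nullary.Decidable using (_×-dec_)
  open Positions (suc m)
  open Energy.Values (suc m) p p' (toℕ<n y')

  private
    n : ℕ
    n = suc m
    a b a' b' : ℕ
    a = toℕ x
    b = toℕ y
    a' = toℕ x'
    b' = toℕ y'
    B B' : Crystal n
    B = pr x y p
    B' = pr x' y' p'

  -- The decisions are passed as variables: `with` cannot abstract them, as χ unfolds them.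
  H-pr-pr-¬opposite : ¬ (bar {n} y' ≡ x) →
    H B B' ≡ χ (x' ≤? x) +ℤ χ (y' ≤? y) -ℤ χ ((y' ≤? y) ×-dec (x <? y') ×-dec (x' ≤? x))
  H-pr-pr-¬opposite ȳ'≢x = by-cases (x' ≤? x) (y' ≤? y) (x <? y')
    where
    suc[a+b']≢N : suc (a + b') ≢ N
    suc[a+b']≢N = ȳ'≢x ∘ Equivalence.from (bar≡⇔ {n} x y')
    by-cases : (a'≤a? : Dec (a' ≤ a)) (b'≤b? : Dec (b' ≤ b)) (a<b'? : Dec (a < b')) →
               H B B' ≡ χ a'≤a? +ℤ χ b'≤b? -ℤ χ (b'≤b? ×-dec a<b'? ×-dec a'≤a?)
    by-cases (yes _)    (yes _)    (no a≮b')  = H-pr-pr p p' (energy-2 (≮⇒≥ a≮b'))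
    by-cases (no a'≰a)  _          (no a≮b')  = contradiction (≤-trans p' (≮⇒≥ a≮b')) a'≰a
    by-cases (yes _)    (no b'≰b)  (no a≮b')  = contradiction (≤-trans (≮⇒≥ a≮b') p) b'≰b
    by-cases (yes a'≤a) (yes _)    (yes a<b') = H-pr-pr p p' (energy-1 a<b' suc[a+b']≢N (inj₁ a'≤a))
    by-cases (yes a'≤a) (no _)     (yes a<b') = H-pr-pr p p' (energy-1 a<b' suc[a+b']≢N (inj₁ a'≤a))
    by-cases (no _)     (yes b'≤b) (yes a<b') = H-pr-pr p p' (energy-1 a<b' suc[a+b']≢N (inj₂ b'≤b))
    by-cases (no a'≰a)  (no b'≰b)  (yes _)    =
      H-pr-pr p p' (energy-0 (≰⇒> a'≰a) (≰⇒> b'≰b) (s≤s z≤n))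

  H-pr-pr-opposite : bar {n} y' ≡ x →
    H B B' ≡ χ (x' <? x) +ℤ χ (y' <? y) -ℤ χ ((y' <? y) ×-dec (x <? y') ×-dec (x' <? x))
  H-pr-pr-opposite ȳ'≡x = by-cases (x' <? x) (y' <? y) (x <? y')
    where
    suc[a+b']≡N : suc (a + b') ≡ N
    suc[a+b']≡N = Equivalence.to (bar≡⇔ {n} x y') ȳ'≡x
    b'<a : ¬ a < b' → b' < a
    b'<a a≮b' = ≤∧≢⇒< (≮⇒≥ a≮b')
      (λ b'≡a → suc[z+z]≢N {a} (subst (λ w → suc (a + w) ≡ N) b'≡a suc[a+b']≡N))
    by-cases : (a'<a? : Dec (a' < a)) (b'<b? : Dec (b' < b)) (a<b'? : Dec (a < b')) →
               H B B' ≡ χ a'<a? +ℤ χ b'<b? -ℤ χ (b'<b? ×-dec a<b'? ×-dec a'<a?)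
    by-cases (yes _)    (yes _)    (no a≮b')  = H-pr-pr p p' (energy-2 (≮⇒≥ a≮b'))
    by-cases (no a'≮a)  _          (no a≮b')  = contradiction (≤-<-trans p' (b'<a a≮b')) a'≮a
    by-cases (yes _)    (no b'≮b)  (no a≮b')  = contradiction (<-≤-trans (b'<a a≮b') p) b'≮b
    by-cases (yes a'<a) (yes _)    (yes a<b') =
      H-pr-pr p p' (energy-1-opposite a<b' suc[a+b']≡N (inj₁ a'<a))
    by-cases (yes a'<a) (no _)     (yes a<b') =
      H-pr-pr p p' (energy-1-opposite a<b' suc[a+b']≡N (inj₁ a'<a))
    by-cases (no _)     (yes b'<b) (yes a<b') =
      H-pr-pr p p' (energy-1-opposite a<b' suc[a+b']≡N (inj₂ b'<b))
    by-cases (no a'≮a)  (no b'≮b)  (yes a<b') =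
      H-pr-pr p p' (energy-0-opposite (≮⇒≥ a'≮a) (≮⇒≥ b'≮b) a<b' suc[a+b']≡N (s≤s z≤n))

open import Data.Integer using (+_; _+_; _-_)
open import Data.Fin using (_≤_; _<_; _≤?_; _<?_)
open import Data.Product using (_×_; _,_)
open import Relation.Nullary using (¬_)
open import Relation.Nullary.Decidable using (_×-dec_)
open import Relation.Binary.PropositionalEquality using (_≡_)

theorem1p7 : (m : ℕ) →
    (H {m} ∅c ∅c ≡ + 0)
    × ((x y : Letter (suc m)) (p : x ≤ y) →
        (H ∅c (pr x y p) ≡ + 1) × (H (pr x y p) ∅c ≡ + 1))
    × ((x y x' y' : Letter (suc m)) (p : x ≤ y) (p' : x' ≤ y') →
        (¬ (bar {suc m} y' ≡ x) →
          H (pr x y p) (pr x' y' p')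
            ≡ χ (x' ≤? x) + χ (y' ≤? y)
              - χ ((y' ≤? y) ×-dec (x <? y') ×-dec (x' ≤? x)))
        × (bar {suc m} y' ≡ x →
          H (pr x y p) (pr x' y' p')
            ≡ χ (x' <? x) + χ (y' <? y)
              - χ ((y' <? y) ×-dec (x <? y') ×-dec (x' <? x))))
theorem1p7 m =
    H-∅-∅ {m}
  , (λ x y p → H-∅-pr x y p , H-pr-∅ x y p)
  , (λ x y x' y' p p' → H-pr-pr-¬opposite x y x' y' p p' , H-pr-pr-opposite x y x' y' p p')
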